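{- Let $(S_0,F_0),\ldots,(S_n,F_n)$ be an evolution of $t$-societies (as defined in the context) and let $\varepsilon=1/(2t)$. If $X$ is a group, then $N^{\alpha}_{0,j}(X)\ge \varepsilon\big(N^{\alpha}_{0,j}(X)+N^{\gamma}_{0,j}(X)\big)$ for every $j$ with $X\in S_j$.
   Context: Let $P$ be a finite poset. A First-Fit chain partition of $P$ is an ordered partition $C_1,\ldots,C_m$ of $P$ into non-empty chains such that whenever $i<j$ and $x\in C_j$, some element of $C_i$ is incomparable to $x$. Fix such a partition and set $C_j=\emptyset$ for $j>m$. A group is a subset of $P$. For a positive integer $t$, a $t$-society is a pair $(S,F)$ where $S$ is a set of groups and $F: S\times\{1,\ldots,t\}\to S\cup\{\star\}$ is a function; $X$ lists $Y$ as a friend in slot $k$ if $F(X,k)=Y$. Let $\varepsilon=1/(2t)$. An evolution is a sequence $(S_0,F_0),\ldots,(S_n,F_n)$ of $t$-societies with $(S_0,F_0)$ arbitrary, $S_n=\emptyset$, and for each $1\le j\le n$: $S_j$ consists exactly of those $X\in S_{j-1}$ satisfying one of the following, and the type of the transition of $X$ from $S_{j-1}$ to $S_j$ is the first rule that applies: ($\alpha$) $X\cap C_j\neq\emptyset$; ($\beta$) otherwise, some friend $F_{j-1}(X,k)\neq\star$ of $X$ in $(S_{j-1},F_{j-1})$ satisfies $F_{j-1}(X,k)\cap C_j\neq\emptyset$; ($\gamma$) otherwise, there is an integer $i$ with $0\le i\le j-1$ and $N^{\alpha}_{i,j-1}(X)>\varepsilon(j-i)$. Here, for $i\le j$ and $a\in\{\alpha,\beta,\gamma\}$,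 $N^a_{i,j}(X)$ is the number of indices $l$ with $i<l\le j$ such that $X\in S_l$ and $X$ makes a transition of type $a$ from $S_{l-1}$ to $S_l$. Friendships are permanent: if $F_{j-1}(X,k)=Y$ and $X,Y\in S_j$, then $F_j(X,k)=Y$; otherwise $F_j(X,k)$ may be any element of $S_j\cup\{\star\}$. -}

module Defs where

open import Data.Nat using (ℕ; zero; suc; _+_; _*_; _∸_; _≤_; _<_; _<ᵇ_)
open import Data.Bool using (Bool; true; false; _∧_; not; if_then_else_)
open import Data.Fin using (Fin)
open import Data.Fin.Subset using (Subset; _∈_; _∩_; Nonempty; Empty)
open import Data.Fin.Subset.Properties using (nonempty?)
open import Data.Maybe using (Maybe; just; nothing)
open import Data.List using (allFin)
open import Data.Bool.ListAction using (any)
open import Data.Product using (Σ; ∃; _×_; _,_)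
open import Data.Sum using (_⊎_)
open import Relation.Nullary using (¬_; does)
open import Relation.Binary.PropositionalEquality using (_≡_)
open import Relation.Binary.Structures using (IsPartialOrder)

-- Finite posets: carrier Fin p with a partial order _≼_.
-- Groups: subsets of the poset, i.e. Subset p.

Incomparable : ∀ {p} → (Fin p → Fin p → Set) → Fin p → Fin p → Set
Incomparable _≼_ x y = ¬ (x ≼ y) × ¬ (y ≼ x)

IsChain : ∀ {p} → (Fin p → Fin p → Set) → Subset p → Set
IsChain _≼_ c = ∀ x y → x ∈ c → y ∈ c → (x ≼ y) ⊎ (y ≼ x)

-- A First-Fit chain partition C₁,…,Cₘ, given as a sequence C : ℕ → Subset p
-- (index 0 is unused), with C j = ∅ for j > m.
record IsFirstFitPartition {p} (_≼_ : Fin p → Fin p → Set)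
                           (m : ℕ) (C : ℕ → Subset p) : Set where
  field
    nonempty  : ∀ j → 1 ≤ j → j ≤ m → Nonempty (C j)
    chain     : ∀ j → 1 ≤ j → j ≤ m → IsChain _≼_ (C j)
    covers    : ∀ x → Σ ℕ λ j → 1 ≤ j × j ≤ m × x ∈ C j
    disjoint  : ∀ x i j → 1 ≤ i → i ≤ m → 1 ≤ j → j ≤ m →
                x ∈ C i → x ∈ C j → i ≡ j
    firstFit  : ∀ i j x → 1 ≤ i → i < j → j ≤ m → x ∈ C j →
                Σ (Fin p) λ y → y ∈ C i × Incomparable _≼_ y x
    emptyAbove : ∀ j x → m < j → ¬ (x ∈ C j)

-- Societies.  A set of groups is given by its (Boolean) characteristic
-- function; F X k = nothing encodes ⋆.

record Society (p t : ℕ) : Set where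
  field
    S : Subset p → Bool
    F : Subset p → Fin t → Maybe (Subset p)

IsSociety : ∀ {p t} → Society p t → Set
IsSociety {p} {t} σ = ∀ (X : Subset p) (k : Fin t) (Y : Subset p) →
  Society.S σ X ≡ true → Society.F σ X k ≡ just Y → Society.S σ Y ≡ true

meets : ∀ {p} → Subset p → Subset p → Bool
meets X C = does (nonempty? (X ∩ C))

friendMeets : ∀ {p t} → (Subset p → Fin t → Maybe (Subset p)) →
              Subset p → Subset p → Bool
friendMeets {p} {t} F X C = any f (allFin t)
  where
  f : Fin t → Bool
  f k with F X k
  ... | nothing = false
  ... | just Y  = meets Y C

countBetween : (ℕ → Bool) → ℕ → ℕ → ℕ
countBetween b i zero    = 0
countBetween b i (suc j) =
  countBetween b i j + (if (i <ᵇ suc j) ∧ b (suc j) then 1 else 0)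

-- transition of X from S_{l-1} to S_l (l ≥ 1) of type α / γ
-- (type β is: in S_l, not α, friend meets C_l; type γ: in S_l, neither α nor β)
isTypeα : ∀ {p t} → (ℕ → Subset p) → (ℕ → Society p t) → Subset p → ℕ → Bool
isTypeα C σ X l = Society.S (σ l) X ∧ meets X (C l)

isTypeγ : ∀ {p t} → (ℕ → Subset p) → (ℕ → Society p t) → Subset p → ℕ → Bool
isTypeγ C σ X l = Society.S (σ l) X ∧ not (meets X (C l))
                  ∧ not (friendMeets (Society.F (σ (l ∸ 1))) X (C l))

Nα : ∀ {p t} → (ℕ → Subset p) → (ℕ → Society p t) → ℕ → ℕ → Subset p → ℕ
Nα C σ i j X = countBetween (isTypeα C σ X) i j

Nγ : ∀ {p t} → (ℕ → Subset p) → (ℕ → Society p t) → ℕ → ℕ → Subset p → ℕ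
Nγ C σ i j X = countBetween (isTypeγ C σ X) i j

-- Rule for S_j (j = suc j', 1 ≤ j ≤ n); ε = 1/(2t), so
-- N > ε (j - i)  ⇔  2t · N > j - i.
SurvivalRule : ∀ {p} (t : ℕ) → (ℕ → Subset p) → (ℕ → Society p t) →
               ℕ → Subset p → Set
SurvivalRule t C σ j' X =
  Society.S (σ j') X ≡ true ×
  ( meets X (C (suc j')) ≡ true
  ⊎ friendMeets (Society.F (σ j')) X (C (suc j')) ≡ true
  ⊎ (Σ ℕ λ i → i ≤ j' × (suc j' ∸ i) < (2 * t) * Nα C σ i j' X))

-- Evolution (S₀,F₀),…,(Sₙ,Fₙ) (the sequence σ is only meaningful for
-- indices 0 … n).
record IsEvolution {p} (t : ℕ) (C : ℕ → Subset p) (n : ℕ)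
                   (σ : ℕ → Society p t) : Set where
  field
    societies : ∀ j → j ≤ n → IsSociety (σ j)
    lastEmpty : ∀ X → Society.S (σ n) X ≡ false
    survive   : ∀ j' X → j' < n →
                Society.S (σ (suc j')) X ≡ true → SurvivalRule t C σ j' X
    survive⁻¹ : ∀ j' X → j' < n →
                SurvivalRule t C σ j' X → Society.S (σ (suc j')) X ≡ true
    permanent : ∀ j' X k Y → j' < n →
                Society.F (σ j') X k ≡ just Y →
                Society.S (σ (suc j')) X ≡ true →
                Society.S (σ (suc j')) Y ≡ true →
                Society.F (σ (suc j')) X k ≡ just Y

-- An α-step adds one to Nα, and 1 ≤ 2t; a β-step changes
-- nothing.  A γ-step at j happens because some window (i, j] satisfies
-- j − i < 2t · Nα_{i,j−1}; since a step is never both of type α and of type γ,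
-- the α- and γ-steps inside the window number at most j − i, so the window on
-- its own satisfies the bound, and adding it to the bound for [0, i] (available
-- because X ∈ S_i) gives the bound for [0, j].
module Submission where

open import Defs
open import Data.Nat using (ℕ; zero; suc; _+_; _*_; _∸_; _≤_; _<_; _<ᵇ_; z≤n; s≤s)
open import Data.Nat.Properties
open import Data.Nat.Induction using (<-rec)
open import Data.Bool using (Bool; true; false; _∧_; not; if_then_else_)
open import Data.Bool.Properties using (∧-zeroʳ)
open import Data.Fin using (Fin)
open import Data.Fin.Subset using (Subset)
open import Data.Product using (_,_; proj₁)
open import Data.Sum using (inj₁; inj₂)
open import Relation.Binary.PropositionalEquality
open import Relation.Binary.Structures using (IsPartialOrder)
open import Relation.Nullary using (contradiction)
open import Relation.Nullary.Reflects using (ofʸ; ofⁿ)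
open import Algebra.Properties.CommutativeSemigroup +-commutativeSemigroup
  using (interchange)

indicator : Bool → ℕ
indicator b = if b then 1 else 0

indicator-∧-disjoint : ∀ a {x y} → (x ∧ y) ≡ false →
                       indicator (a ∧ x) + indicator (a ∧ y) ≤ indicator a
indicator-∧-disjoint false _ = z≤n
indicator-∧-disjoint true {true}  {true}  ()
indicator-∧-disjoint true {true}  {false} _ = ≤-refl
indicator-∧-disjoint true {false} {true}  _ = ≤-refl
indicator-∧-disjoint true {false} {false} _ = z≤n

<ᵇ-true : ∀ {m n} → m < n → (m <ᵇ n) ≡ true
<ᵇ-true {zero}  {suc n} _         = refl
<ᵇ-true {suc m} {suc n} (s≤s m<n) = <ᵇ-true m<n

<ᵇ-false : ∀ {m n} → n ≤ m → (m <ᵇ n) ≡ false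
<ᵇ-false {m}     {zero}  _         = refl
<ᵇ-false {suc m} {suc n} (s≤s n≤m) = <ᵇ-false n≤m

∸-+-indicator-<ᵇ : ∀ l i → l ∸ i + indicator (i <ᵇ suc l) ≡ suc l ∸ i
∸-+-indicator-<ᵇ l i with i <ᵇ suc l | <ᵇ-reflects-< i (suc l)
... | true  | ofʸ (s≤s i≤l) = trans (+-comm (l ∸ i) 1) (sym (+-∸-assoc 1 i≤l))
... | false | ofⁿ i≮1+l     = begin
  l ∸ i + 0  ≡⟨ +-identityʳ (l ∸ i) ⟩
  l ∸ i      ≡⟨ m≤n⇒m∸n≡0 (≤-trans (n≤1+n l) 1+l≤i) ⟩
  0          ≡⟨ m≤n⇒m∸n≡0 1+l≤i ⟨
  suc l ∸ i  ∎
  where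
  open ≡-Reasoning
  1+l≤i : suc l ≤ i
  1+l≤i = ≮⇒≥ i≮1+l

module _ (b : ℕ → Bool) where

  countBetween-empty : ∀ {i} j → j ≤ i → countBetween b i j ≡ 0
  countBetween-empty zero    _   = refl
  countBetween-empty (suc j) j<i
    rewrite countBetween-empty j (≤-trans (n≤1+n j) j<i) | <ᵇ-false j<i = refl

  countBetween-suc : ∀ {i j} → i ≤ j →
                     countBetween b i (suc j) ≡ countBetween b i j + indicator (b (suc j))
  countBetween-suc i≤j rewrite <ᵇ-true (s≤s i≤j) = refl

  countBetween-hit : ∀ {i j} → i ≤ j → b (suc j) ≡ true →
                     countBetween b i (suc j) ≡ suc (countBetween b i j)
  countBetween-hit {i} {j} i≤j hit rewrite countBetween-suc i≤j | hit =
    +-comm (countBetween b i j) 1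

  countBetween-miss : ∀ i j → b (suc j) ≡ false →
                      countBetween b i (suc j) ≡ countBetween b i j
  countBetween-miss i j miss rewrite miss | ∧-zeroʳ (i <ᵇ suc j) = +-identityʳ _

  countBetween-split : ∀ {h i} l → h ≤ i → i ≤ l →
                       countBetween b h l ≡ countBetween b h i + countBetween b i l
  countBetween-split zero    _   z≤n = refl
  countBetween-split {h} {i} (suc l) h≤i i≤1+l with m≤n⇒m<n∨m≡n i≤1+l
  ... | inj₂ refl =
    sym (trans (cong (countBetween b h (suc l) +_) (countBetween-empty (suc l) ≤-refl))
               (+-identityʳ _))
  ... | inj₁ (s≤s i≤l) = begin
    countBetween b h (suc l)                               ≡⟨ countBetween-suc (≤-trans h≤i i≤l) ⟩
    countBetween b h l + x                                 ≡⟨ cong (_+ x) (countBetween-split l h≤i i≤l) ⟩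
    countBetween b h i + countBetween b i l + x            ≡⟨ +-assoc (countBetween b h i) _ x ⟩
    countBetween b h i + (countBetween b i l + x)          ≡⟨ cong (countBetween b h i +_) (countBetween-suc i≤l) ⟨
    countBetween b h i + countBetween b i (suc l)          ∎
    where
    open ≡-Reasoning
    x = indicator (b (suc l))

countBetween-disjoint : ∀ b c → (∀ k → (b k ∧ c k) ≡ false) →
                        ∀ i l → countBetween b i l + countBetween c i l ≤ l ∸ i
countBetween-disjoint b c disjoint i zero    = z≤n
countBetween-disjoint b c disjoint i (suc l) = begin
  (B + x) + (C + y)                  ≡⟨ interchange B x C y ⟩
  (B + C) + (x + y)                  ≤⟨ +-mono-≤ (countBetween-disjoint b c disjoint i l)
                                                  (indicator-∧-disjoint (i <ᵇ suc l) (disjoint (suc l))) ⟩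
  l ∸ i + indicator (i <ᵇ suc l)     ≡⟨ ∸-+-indicator-<ᵇ l i ⟩
  suc l ∸ i                          ∎
  where
  open ≤-Reasoning
  B = countBetween b i l
  C = countBetween c i l
  x = indicator ((i <ᵇ suc l) ∧ b (suc l))
  y = indicator ((i <ᵇ suc l) ∧ c (suc l))

-- a ≥ (a + g) / T, with the division multiplied out.
ShareAtLeast : ℕ → ℕ → ℕ → Set
ShareAtLeast T a g = a + g ≤ T * a

shareAtLeast-suc : ∀ {T a g} → 1 ≤ T → ShareAtLeast T a g → ShareAtLeast T (suc a) g
shareAtLeast-suc {T} {a} 1≤T share =
  ≤-trans (+-mono-≤ 1≤T share) (≤-reflexive (sym (*-suc T a)))

shareAtLeast-+ : ∀ {T a g a′ g′} → ShareAtLeast T a g → ShareAtLeast T a′ g′ →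
                 ShareAtLeast T (a + a′) (g + g′)
shareAtLeast-+ {T} {a} {g} {a′} {g′} share share′ = begin
  (a + a′) + (g + g′)  ≡⟨ interchange a a′ g g′ ⟩
  (a + g) + (a′ + g′)  ≤⟨ +-mono-≤ share share′ ⟩
  T * a + T * a′       ≡⟨ *-distribˡ-+ T a a′ ⟨
  T * (a + a′)         ∎
  where open ≤-Reasoning

module Evolution {p t n} {C : ℕ → Subset p} {σ : ℕ → Society p t}
                 (evolution : IsEvolution t C n σ) (X : Subset p) where

  open IsEvolution evolution

  Alive : ℕ → Set
  Alive j = Society.S (σ j) X ≡ true

  α γ : ℕ → Bool
  α = isTypeα C σ X
  γ = isTypeγ C σ X

  alive-downward : ∀ {i l} → i ≤ l → l ≤ n → Alive l → Alive i
  alive-downward {i} {l} i≤l l≤n alive with m≤n⇒m<n∨m≡n i≤l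
  ... | inj₂ refl = alive
  alive-downward {i} {suc l} _ l<n alive | inj₁ (s≤s i≤l) =
    alive-downward i≤l (≤-trans (n≤1+n l) l<n) (proj₁ (survive l X l<n alive))

  α-needs-meets : ∀ {l} → meets X (C l) ≡ false → α l ≡ false
  α-needs-meets miss rewrite miss = ∧-zeroʳ _

  γ-excludes-meets : ∀ {l} → meets X (C l) ≡ true → γ l ≡ false
  γ-excludes-meets hit rewrite hit = ∧-zeroʳ _

  γ-excludes-friendMeets : ∀ {l} → friendMeets (Society.F (σ (l ∸ 1))) X (C l) ≡ true →
                           γ l ≡ false
  γ-excludes-friendMeets {l} hit rewrite hit | ∧-zeroʳ (not (meets X (C l))) =
    ∧-zeroʳ _

  α-γ-disjoint : ∀ l → (α l ∧ γ l) ≡ false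
  α-γ-disjoint l with Society.S (σ l) X | meets X (C l)
  ... | true  | true  = refl
  ... | true  | false = refl
  ... | false | _     = refl

  module _ (1≤t : 1 ≤ t) where

    Share : ℕ → Set
    Share j = ShareAtLeast (2 * t) (Nα C σ 0 j X) (Nγ C σ 0 j X)

    share-α : ∀ j → Alive (suc j) → meets X (C (suc j)) ≡ true → Share j → Share (suc j)
    share-α j alive hit share
      rewrite countBetween-hit α z≤n (cong₂ _∧_ alive hit)
            | countBetween-miss γ 0 j (γ-excludes-meets hit) =
      shareAtLeast-suc (≤-trans 1≤t (m≤n*m t 2)) share

    share-β : ∀ j → meets X (C (suc j)) ≡ false →
              friendMeets (Society.F (σ j)) X (C (suc j)) ≡ true → Share j → Share (suc j)
    share-β j miss hit share
      rewrite countBetween-miss α 0 j (α-needs-meets miss)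
            | countBetween-miss γ 0 j (γ-excludes-friendMeets hit) = share

    share-γ : ∀ {i} j → i ≤ j → meets X (C (suc j)) ≡ false →
              suc j ∸ i < (2 * t) * Nα C σ i j X → Share i → Share (suc j)
    share-γ {i} j i≤j miss dense share =
      subst₂ (ShareAtLeast (2 * t))
        (sym (countBetween-split α (suc j) z≤n i≤1+j))
        (sym (countBetween-split γ (suc j) z≤n i≤1+j))
        (shareAtLeast-+ {2 * t} {Nα C σ 0 i X} {Nγ C σ 0 i X} share window)
      where
      i≤1+j = ≤-trans i≤j (n≤1+n j)
      window : ShareAtLeast (2 * t) (Nα C σ i (suc j) X) (Nγ C σ i (suc j) X)
      window = begin
        Nα C σ i (suc j) X + Nγ C σ i (suc j) X  ≤⟨ countBetween-disjoint α γ α-γ-disjoint i (suc j) ⟩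
        suc j ∸ i                                 ≤⟨ <⇒≤ dense ⟩
        2 * t * Nα C σ i j X                      ≡⟨ cong (2 * t *_) (countBetween-miss α i j (α-needs-meets miss)) ⟨
        2 * t * Nα C σ i (suc j) X                ∎
        where open ≤-Reasoning

    share-step : ∀ j → suc j ≤ n → Alive (suc j) → (∀ i → i ≤ j → Alive i → Share i) →
                 ∀ {b} → meets X (C (suc j)) ≡ b → Share (suc j)
    share-step j j<n alive share< {true} hit =
      share-α j alive hit (share< j ≤-refl (proj₁ (survive j X j<n alive)))
    share-step j j<n alive share< {false} miss with survive j X j<n alive
    ... | _ , inj₁ hit = contradiction (trans (sym hit) miss) λ ()
    ... | aliveʲ , inj₂ (inj₁ friend) = share-β j miss friend (share< j ≤-refl aliveʲ)
    ... | _ , inj₂ (inj₂ (i , i≤j , dense)) =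
      share-γ j i≤j miss dense
        (share< i i≤j (alive-downward (≤-trans i≤j (n≤1+n j)) j<n alive))

    share : ∀ j → j ≤ n → Alive j → Share j
    share = <-rec (λ j → j ≤ n → Alive j → Share j) step
      where
      step : ∀ j → (∀ {i} → i < j → i ≤ n → Alive i → Share i) → j ≤ n → Alive j → Share j
      step zero    _     _   _     = z≤n
      step (suc j) share< j<n alive = share-step j j<n alive
        (λ i i≤j → share< (s≤s i≤j) (≤-trans i≤j (≤-trans (n≤1+n j) j<n))) refl

lemma3 : (p : ℕ) (_≼_ : Fin p → Fin p → Set) → IsPartialOrder _≡_ _≼_ →
    (m : ℕ) (C : ℕ → Subset p) → IsFirstFitPartition _≼_ m C →
    (t : ℕ) → 1 ≤ t →
    (n : ℕ) (σ : ℕ → Society p t) → IsEvolution t C n σ →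
    (X : Subset p) (j : ℕ) → j ≤ n → Society.S (σ j) X ≡ true →
    Nα C σ 0 j X + Nγ C σ 0 j X ≤ (2 * t) * Nα C σ 0 j X
lemma3 p _≼_ _ m C _ t 1≤t n σ evolution X = Evolution.share evolution X 1≤t
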